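{- Let $D=(V,E)$ be a finite strongly connected digraph without loops. Then the strongly biconnected components of $D$ are exactly the induced sub-digraphs $D[V(B)]$, where $B$ ranges over the biconnected components of the underlying graph $\mathcal{G}(D)$.
   Context: $\mathcal{G}(D)$ is the undirected graph on $V$ with edges $\{v,w\}$ for $(v,w)\in E$. A graph is biconnected if it is connected and has no cut vertex (a vertex whose removal increases the number of connected components); the one-vertex graph is biconnected; biconnected components are maximal biconnected subgraphs. A digraph is strongly biconnected if it is strongly connected and its underlying graph is biconnected (the one-vertex digraph with no arcs is strongly biconnected); the strongly biconnected components of $D$ are its maximal strongly biconnected sub-digraphs. $D[X]$ denotes the sub-digraph $(X,E\cap X\times X)$. -}

module Defs where

open import Data.Nat using (ℕ)
open import Data.Fin using (Fin; _≟_)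
open import Data.Bool using (Bool; true; false; T; _∧_; _∨_; not)
open import Data.Product using (Σ; ∃; _×_)
open import Relation.Binary.PropositionalEquality using (_≡_; _≢_)
open import Relation.Nullary.Decidable using (⌊_⌋)

Digraph : ℕ → Set
Digraph n = Fin n → Fin n → Bool

VSet : ℕ → Set
VSet n = Fin n → Bool

ASet : ℕ → Set
ASet n = Fin n → Fin n → Bool

Loopless : ∀ {n} → Digraph n → Set
Loopless E = ∀ v → E v v ≡ false

data Path {n : ℕ} (R : ASet n) : Fin n → Fin n → Set where
  here : ∀ {v} → Path R v v
  step : ∀ {u v w} → T (R u v) → Path R v w → Path R u w

symᵃ : ∀ {n} → ASet n → ASet n
symᵃ F u v = F u v ∨ F v u

IsSubdigraph : ∀ {n} → Digraph n → VSet n → ASet n → Set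
IsSubdigraph E X F = ∀ u v → T (F u v) → T (E u v) × T (X u) × T (X v)

-- (X , F) is an (undirected) subgraph of the undirected graph G
-- (undirected graphs are represented by symmetric edge relations).
IsSubgraph : ∀ {n} → ASet n → VSet n → ASet n → Set
IsSubgraph G X F = (∀ u v → T (F u v) → T (F v u)) × IsSubdigraph G X F

StronglyConnected : ∀ {n} → VSet n → ASet n → Set
StronglyConnected X F =
  (∃ λ v → T (X v)) × (∀ u v → T (X u) → T (X v) → Path F u v)

-- Connectivity of an undirected graph (X , F) with F symmetric.
Connected : ∀ {n} → VSet n → ASet n → Set
Connected X F =
  (∃ λ v → T (X v)) × (∀ u v → T (X u) → T (X v) → Path F u v)

delete : ∀ {n} → Fin n → ASet n → ASet n
delete x F u v = F u v ∧ not ⌊ u ≟ x ⌋ ∧ not ⌊ v ≟ x ⌋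

-- Biconnected: connected and no cut vertex. For a connected graph, x is a
-- cut vertex iff two vertices other than x are disconnected once x is removed.
Biconnected : ∀ {n} → VSet n → ASet n → Set
Biconnected X F =
  Connected X F ×
  (∀ x u w → T (X x) → T (X u) → T (X w) → u ≢ x → w ≢ x →
     Path (delete x F) u w)

StronglyBiconnected : ∀ {n} → VSet n → ASet n → Set
StronglyBiconnected X F = StronglyConnected X F × Biconnected X (symᵃ F)

_⊑_ : ∀ {n} → VSet n × ASet n → VSet n × ASet n → Set
(X Data.Product., F) ⊑ (X' Data.Product., F') =
  (∀ v → T (X v) → T (X' v)) × (∀ u v → T (F u v) → T (F' u v))

open Data.Product using (_,_)

IsSBComponent : ∀ {n} → Digraph n → VSet n → ASet n → Set
IsSBComponent E X F =
  IsSubdigraph E X F × StronglyBiconnected X F ×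
  (∀ X' F' → IsSubdigraph E X' F' → StronglyBiconnected X' F' →
     (X , F) ⊑ (X' , F') → (X' , F') ⊑ (X , F))

IsBiconnectedComponent : ∀ {n} → ASet n → VSet n → ASet n → Set
IsBiconnectedComponent G X F =
  IsSubgraph G X F × Biconnected X F ×
  (∀ X' F' → IsSubgraph G X' F' → Biconnected X' F' →
     (X , F) ⊑ (X' , F') → (X' , F') ⊑ (X , F))

Underlying : ∀ {n} → Digraph n → ASet n
Underlying E = symᵃ E

allV : ∀ {n} → VSet n
allV _ = true

Induced : ∀ {n} → Digraph n → VSet n → ASet n
Induced E X u v = E u v ∧ X u ∧ X v

-- The heart of the proof is an ear extension.  Let B = (X , F) be a
-- biconnected subgraph of 𝒢(D).  For all s , t ∈ X pick a simple directed
-- path of D from s to t (an ear), and let Y consist of X and all vertices on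
-- these ears.  Then
--   * D[Y] is strongly connected: a vertex on an ear reaches the end of the
--     ear and is reached from its start, both in X, and X is linked by ears;
--   * 𝒢(D[Y]) is biconnected: after deleting x ≠ z, a vertex z on a simple
--     ear still reaches one of the two ends of that ear, and the ends are
--     joined in B - x (or in B itself if x ∉ X);
--   * B ⊆ 𝒢(D[Y]).
-- If B is a biconnected component, maximality gives Y = X, so D[X] is
-- strongly biconnected.  If S is a strongly biconnected component and B is
-- a biconnected subgraph containing 𝒢(S), then D[Y] ⊇ S gives V(B) ⊆ V(S).
module Submission where

open import Defs
open import Data.Nat using (ℕ)
open import Data.Fin using (Fin; _≟_)
open import Data.Fin.Properties using (any?)
open import Data.Bool using (true; T; _∨_)
open import Data.Bool.Properties using (T-∧; T-∨; T-≡; ⇔→≡)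
open import Data.Product using (Σ; ∃; ∃₂; _×_; _,_; proj₁; proj₂)
open import Data.Sum as Sum using (_⊎_; inj₁; inj₂)
open import Data.Unit using (⊤; tt)
open import Data.List using (List; _∷_; [_])
open import Data.List.Relation.Unary.Any using (here; there)
open import Data.List.Membership.Propositional using (_∈_; _∉_)
open import Data.List.Relation.Binary.Subset.Propositional using (_⊆_)
open import Data.List.Relation.Binary.Subset.Propositional.Properties using (∷⁺ʳ; ∈-∷⁺ʳ)
open import Relation.Nullary using (yes; no)
open import Relation.Nullary.Decidable using (⌊_⌋; _×-dec_; T?; toWitness; fromWitness; toWitnessFalse; fromWitnessFalse)
open import Relation.Unary using (Decidable)
open import Relation.Binary.PropositionalEquality using (_≡_; refl; sym; _≢_; subst)
open import Function using (_∘_; id)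
open import Function.Bundles using (_⇔_; mk⇔; Equivalence)

open Equivalence using (to; from)

T-ext : ∀ {a b} → (T a → T b) → (T b → T a) → a ≡ b
T-ext f g = ⇔→≡ {z = true} (mk⇔ (to T-≡ ∘ f ∘ from T-≡) (to T-≡ ∘ g ∘ from T-≡))

module _ {n : ℕ} where

  open import Data.List.Membership.DecPropositional (_≟_ {n}) using (_∈?_)

  vertices : ∀ {R : ASet n} {a b} → Path R a b → List (Fin n)
  vertices (here {v}) = [ v ]
  vertices (step {u} _ p) = u ∷ vertices p

  Simple : ∀ {R : ASet n} {a b} → Path R a b → Set
  Simple here = ⊤
  Simple (step {u} _ p) = u ∉ vertices p × Simple p

  first∈ : ∀ {R : ASet n} {a b} (p : Path R a b) → a ∈ vertices p
  first∈ here = here refl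
  first∈ (step _ _) = here refl

  last∈ : ∀ {R : ASet n} {a b} (p : Path R a b) → b ∈ vertices p
  last∈ here = here refl
  last∈ (step _ p) = there (last∈ p)

  _++ₚ_ : ∀ {R : ASet n} {a b c} → Path R a b → Path R b c → Path R a c
  here ++ₚ q = q
  step r p ++ₚ q = step r (p ++ₚ q)

  suffix : ∀ {R : ASet n} {a b z} (p : Path R a b) → z ∈ vertices p → Path R z b
  suffix here (here refl) = here
  suffix (step r p) (here refl) = step r p
  suffix (step _ p) (there i) = suffix p i

  prefix : ∀ {R : ASet n} {a b z} (p : Path R a b) → z ∈ vertices p → Path R a z
  prefix here (here refl) = here
  prefix (step _ _) (here refl) = here
  prefix (step r p) (there i) = step r (prefix p i)

  suffix-⊆ : ∀ {R : ASet n} {a b z} (p : Path R a b) (i : z ∈ vertices p) →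
    vertices (suffix p i) ⊆ vertices p
  suffix-⊆ here (here refl) = id
  suffix-⊆ (step _ _) (here refl) = id
  suffix-⊆ (step _ p) (there i) = there ∘ suffix-⊆ p i

  prefix-⊆ : ∀ {R : ASet n} {a b z} (p : Path R a b) (i : z ∈ vertices p) →
    vertices (prefix p i) ⊆ vertices p
  prefix-⊆ here (here refl) = id
  prefix-⊆ (step _ _) (here refl) = ∈-∷⁺ʳ (here refl) λ ()
  prefix-⊆ (step {u} _ p) (there i) = ∷⁺ʳ u (prefix-⊆ p i)

  suffix-simple : ∀ {R : ASet n} {a b z} (p : Path R a b) (i : z ∈ vertices p) →
    Simple p → Simple (suffix p i)
  suffix-simple here (here refl) s = s
  suffix-simple (step _ _) (here refl) s = s
  suffix-simple (step _ p) (there i) (_ , s) = suffix-simple p i s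

  simplify : ∀ {R : ASet n} {a b} → Path R a b → Σ (Path R a b) Simple
  simplify here = here , tt
  simplify (step {u} r p) with simplify p
  ... | q , simple-q with u ∈? vertices q
  ...   | yes i = suffix q i , suffix-simple q i simple-q
  ...   | no u∉q = step r q , u∉q , simple-q

  -- A vertex x ≠ z occurs at most once on a simple path, so it misses the
  -- part before z or the part after z.
  avoid-one-side : ∀ {R : ASet n} {a b z x} (p : Path R a b) → Simple p →
    (i : z ∈ vertices p) → z ≢ x →
    x ∉ vertices (prefix p i) ⊎ x ∉ vertices (suffix p i)
  avoid-one-side here _ (here refl) z≢x = inj₁ λ { (here x≡z) → z≢x (sym x≡z) }
  avoid-one-side (step _ _) _ (here refl) z≢x = inj₁ λ { (here x≡z) → z≢x (sym x≡z) }
  avoid-one-side {x = x} (step {u} _ p) (u∉p , simple-p) (there i) z≢x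
    with avoid-one-side p simple-p i z≢x
  ... | inj₂ x∉suffix = inj₂ x∉suffix
  ... | inj₁ x∉prefix with x ≟ u
  ...   | yes refl = inj₂ (u∉p ∘ suffix-⊆ p i)
  ...   | no x≢u = inj₁ λ { (here x≡u) → x≢u x≡u ; (there j) → x∉prefix j }

  _⊆ᵥ_ : VSet n → VSet n → Set
  X ⊆ᵥ X' = ∀ v → T (X v) → T (X' v)

  ⊆ᵥ-refl : ∀ {X : VSet n} → X ⊆ᵥ X
  ⊆ᵥ-refl _ x = x

  ⊆ᵥ-trans : ∀ {X Y Z : VSet n} → X ⊆ᵥ Y → Y ⊆ᵥ Z → X ⊆ᵥ Z
  ⊆ᵥ-trans X⊆Y Y⊆Z v = Y⊆Z v ∘ X⊆Y v

  ≡⇒⊆ᵥ : ∀ {X Y : VSet n} → (∀ v → X v ≡ Y v) → X ⊆ᵥ Y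
  ≡⇒⊆ᵥ X≡Y v = subst T (X≡Y v)

  _⊆ₐ_ : ASet n → ASet n → Set
  R ⊆ₐ S = ∀ u v → T (R u v) → T (S u v)

  ⊆ₐ-trans : ∀ {R S U : ASet n} → R ⊆ₐ S → S ⊆ₐ U → R ⊆ₐ U
  ⊆ₐ-trans R⊆S S⊆U u v = S⊆U u v ∘ R⊆S u v

  ≡⇒⊆ₐ : ∀ {R S : ASet n} → (∀ u v → R u v ≡ S u v) → R ⊆ₐ S
  ≡⇒⊆ₐ R≡S u v = subst T (R≡S u v)

  Symmetricₐ : ASet n → Set
  Symmetricₐ R = ∀ u v → T (R u v) → T (R v u)

  mapₚ : ∀ {R S : ASet n} {a b} → R ⊆ₐ S → Path R a b → Path S a b
  mapₚ _ here = here
  mapₚ R⊆S (step {u} {v} r p) = step (R⊆S u v r) (mapₚ R⊆S p)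

  reverseₚ : ∀ {R : ASet n} {a b} → Symmetricₐ R → Path R a b → Path R b a
  reverseₚ _ here = here
  reverseₚ sym-R (step {u} {v} r p) = reverseₚ sym-R p ++ₚ step (sym-R u v r) here

  transfer : ∀ {R S : ASet n} {a b} (Q : Fin n → Set) →
    (∀ {u v} → T (R u v) → Q u → Q v → T (S u v)) →
    (p : Path R a b) → (∀ {y} → y ∈ vertices p → Q y) → Path S a b
  transfer Q arc here _ = here
  transfer Q arc (step r p) on-p =
    step (arc r (on-p (here refl)) (on-p (there (first∈ p)))) (transfer Q arc p (on-p ∘ there))

  ⊆symᵃ : (R : ASet n) → R ⊆ₐ symᵃ R
  ⊆symᵃ R u v r = from T-∨ (inj₁ r)

  symᵃ-symmetric : (R : ASet n) → Symmetricₐ (symᵃ R)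
  symᵃ-symmetric R u v r = from (T-∨ {R v u}) (Sum.swap (to (T-∨ {R u v}) r))

  symᵃ-mono : ∀ {R S : ASet n} → R ⊆ₐ S → symᵃ R ⊆ₐ symᵃ S
  symᵃ-mono R⊆S u v r = from T-∨ (Sum.map (R⊆S u v) (R⊆S v u) (to T-∨ r))

  induced⁺ : (E : Digraph n) (Y : VSet n) {u v : Fin n} →
    T (E u v) → T (Y u) → T (Y v) → T (Induced E Y u v)
  induced⁺ E Y e yu yv = from T-∧ (e , from T-∧ (yu , yv))

  induced-subdigraph : (E : Digraph n) (Y : VSet n) → IsSubdigraph E Y (Induced E Y)
  induced-subdigraph E Y u v i = let (e , y) = to T-∧ i in e , to T-∧ y

  induced-mono : (E : Digraph n) {Y Y' : VSet n} → Y ⊆ᵥ Y' → Induced E Y ⊆ₐ Induced E Y'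
  induced-mono E {Y} {Y'} Y⊆Y' u v i =
    let (e , yu , yv) = induced-subdigraph E Y u v i in induced⁺ E Y' e (Y⊆Y' u yu) (Y⊆Y' v yv)

  subdigraph⊆induced : ∀ {E : Digraph n} {X F} → IsSubdigraph E X F → F ⊆ₐ Induced E X
  subdigraph⊆induced {E} {X} sub u v f = let (e , xu , xv) = sub u v f in induced⁺ E X e xu xv

  subdigraph⇒subgraph : ∀ {E : Digraph n} {X F} → IsSubdigraph E X F →
    IsSubgraph (symᵃ E) X (symᵃ F)
  subdigraph⇒subgraph {E} {X} {F} sub = symᵃ-symmetric F , λ u v f → arc u v (to T-∨ f)
    where
    arc : ∀ u v → T (F u v) ⊎ T (F v u) → T (symᵃ E u v) × T (X u) × T (X v)
    arc u v (inj₁ f) = let (e , xu , xv) = sub u v f in from T-∨ (inj₁ e) , xu , xv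
    arc u v (inj₂ f) = let (e , xv , xu) = sub v u f in from T-∨ (inj₂ e) , xu , xv

  subgraph⊆sym-induced : (E : Digraph n) {X : VSet n} {F : ASet n} →
    IsSubgraph (symᵃ E) X F → F ⊆ₐ symᵃ (Induced E X)
  subgraph⊆sym-induced E {X} (_ , sub) u v f with sub u v f
  ... | e , xu , xv =
    from T-∨ (Sum.map (λ e → induced⁺ E X e xu xv) (λ e → induced⁺ E X e xv xu) (to T-∨ e))

  delete⁺ : (R : ASet n) {x u v : Fin n} → T (R u v) → u ≢ x → v ≢ x → T (delete x R u v)
  delete⁺ R {x} {u} {v} r u≢x v≢x =
    from T-∧ (r , from T-∧ (fromWitnessFalse {a? = u ≟ x} u≢x , fromWitnessFalse {a? = v ≟ x} v≢x))

  delete⁻ : (R : ASet n) {x u v : Fin n} → T (delete x R u v) → T (R u v) × u ≢ x × v ≢ x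
  delete⁻ R {x} {u} {v} d = let (r , ends) = to T-∧ d ; (u≢x , v≢x) = to T-∧ ends in
    r , toWitnessFalse {a? = u ≟ x} u≢x , toWitnessFalse {a? = v ≟ x} v≢x

  delete-mono : ∀ {R S : ASet n} x → R ⊆ₐ S → delete x R ⊆ₐ delete x S
  delete-mono {R} {S} x R⊆S u v d =
    let (r , u≢x , v≢x) = delete⁻ R d in delete⁺ S (R⊆S u v r) u≢x v≢x

  delete-symmetric : ∀ {R : ASet n} x → Symmetricₐ R → Symmetricₐ (delete x R)
  delete-symmetric {R} x sym-R u v d =
    let (r , u≢x , v≢x) = delete⁻ R d in delete⁺ R (sym-R u v r) v≢x u≢x

  -- Connectivity and biconnectivity only depend on the vertex set, and are
  -- preserved by adding edges.  (Connected is defined as StronglyConnected.)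

  connected-transport : ∀ {X X' : VSet n} {F F' : ASet n} → X ⊆ᵥ X' → X' ⊆ᵥ X → F ⊆ₐ F' →
    StronglyConnected X F → StronglyConnected X' F'
  connected-transport X⊆X' X'⊆X F⊆F' ((v , xv) , path) =
    (v , X⊆X' v xv) , λ u w x'u x'w → mapₚ F⊆F' (path u w (X'⊆X u x'u) (X'⊆X w x'w))

  biconnected-transport : ∀ {X X' : VSet n} {F F' : ASet n} → X ⊆ᵥ X' → X' ⊆ᵥ X → F ⊆ₐ F' →
    Biconnected X F → Biconnected X' F'
  biconnected-transport X⊆X' X'⊆X F⊆F' (conn , path) =
    connected-transport X⊆X' X'⊆X F⊆F' conn ,
    λ x u w x'x x'u x'w u≢x w≢x →
      mapₚ (delete-mono x F⊆F') (path x u w (X'⊆X x x'x) (X'⊆X u x'u) (X'⊆X w x'w) u≢x w≢x)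

  induced-strongly-biconnected : ∀ {E : Digraph n} {X F} → IsSubdigraph E X F →
    StronglyBiconnected X F → StronglyBiconnected X (Induced E X)
  induced-strongly-biconnected {E} {X} {F} sub (sc , bic) =
    connected-transport ⊆ᵥ-refl ⊆ᵥ-refl F⊆I sc ,
    biconnected-transport ⊆ᵥ-refl ⊆ᵥ-refl (symᵃ-mono F⊆I) bic
    where
    F⊆I : F ⊆ₐ Induced E X
    F⊆I = subdigraph⊆induced sub

module EarExtension {n : ℕ} (E : Digraph n) (reach : ∀ u v → Path E u v)
                    (X : VSet n) (F : ASet n)
                    (B-sub : IsSubgraph (symᵃ E) X F) (B-bic : Biconnected X F) where

  open import Data.List.Membership.DecPropositional (_≟_ {n}) using (_∈?_)

  ear : (s t : Fin n) → Path E s t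
  ear s t = proj₁ (simplify (reach s t))

  ear-simple : ∀ s t → Simple (ear s t)
  ear-simple s t = proj₂ (simplify (reach s t))

  OnEar : Fin n → Set
  OnEar z = ∃₂ λ s t → T (X s) × T (X t) × z ∈ vertices (ear s t)

  onEar? : Decidable OnEar
  onEar? z = any? λ s → any? λ t → T? (X s) ×-dec T? (X t) ×-dec (z ∈? vertices (ear s t))

  Y : VSet n
  Y z = X z ∨ ⌊ onEar? z ⌋

  X⊆Y : X ⊆ᵥ Y
  X⊆Y z xz = from (T-∨ {X z}) (inj₁ xz)

  ear⊆Y : ∀ {s t z} → T (X s) → T (X t) → z ∈ vertices (ear s t) → T (Y z)
  ear⊆Y {s} {t} {z} xs xt i =
    from (T-∨ {X z}) (inj₂ (fromWitness {a? = onEar? z} (s , t , xs , xt , i)))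

  Y-cases : ∀ {z} → T (Y z) → T (X z) ⊎ OnEar z
  Y-cases {z} yz = Sum.map₂ (toWitness {a? = onEar? z}) (to (T-∨ {X z}) yz)

  Y-nonempty : ∃ λ v → T (Y v)
  Y-nonempty = let (v , xv) = proj₁ (proj₁ B-bic) in v , X⊆Y v xv

  ear-piece : ∀ {s t a b} → T (X s) → T (X t) → (q : Path E a b) →
    vertices q ⊆ vertices (ear s t) → Path (Induced E Y) a b
  ear-piece xs xt q q⊆ear = transfer (T ∘ Y) (induced⁺ E Y) q (ear⊆Y xs xt ∘ q⊆ear)

  -- In D[Y], every vertex reaches X (along the rest of its ear) and is
  -- reached from X (along the beginning of its ear).
  to-X : ∀ {z} → T (Y z) → ∃ λ h → T (X h) × Path (Induced E Y) z h
  to-X {z} yz with Y-cases yz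
  ... | inj₁ xz = z , xz , here
  ... | inj₂ (s , t , xs , xt , i) =
    t , xt , ear-piece xs xt (suffix (ear s t) i) (suffix-⊆ (ear s t) i)

  from-X : ∀ {z} → T (Y z) → ∃ λ h → T (X h) × Path (Induced E Y) h z
  from-X {z} yz with Y-cases yz
  ... | inj₁ xz = z , xz , here
  ... | inj₂ (s , t , xs , xt , i) =
    s , xs , ear-piece xs xt (prefix (ear s t) i) (prefix-⊆ (ear s t) i)

  Y-strongly-connected : StronglyConnected Y (Induced E Y)
  Y-strongly-connected = Y-nonempty , path
    where
    path : ∀ u w → T (Y u) → T (Y w) → Path (Induced E Y) u w
    path u w yu yw with to-X yu | from-X yw
    ... | h₁ , x₁ , p₁ | h₂ , x₂ , p₂ = p₁ ++ₚ (ear-piece x₁ x₂ (ear h₁ h₂) id ++ₚ p₂)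

  G : ASet n
  G = symᵃ (Induced E Y)

  G-symmetric : ∀ x → Symmetricₐ (delete x G)
  G-symmetric x = delete-symmetric x (symᵃ-symmetric (Induced E Y))

  B⊆G : F ⊆ₐ G
  B⊆G u v f = symᵃ-mono (induced-mono E X⊆Y) u v (subgraph⊆sym-induced E B-sub u v f)

  ear-piece-avoiding : ∀ {s t a b} x → T (X s) → T (X t) → (q : Path E a b) →
    vertices q ⊆ vertices (ear s t) → x ∉ vertices q → Path (delete x G) a b
  ear-piece-avoiding x xs xt q q⊆ear x∉q =
    transfer (λ y → T (Y y) × y ≢ x) arc q λ i → ear⊆Y xs xt (q⊆ear i) , λ { refl → x∉q i }
    where
    arc : ∀ {u v} → T (E u v) → T (Y u) × u ≢ x → T (Y v) × v ≢ x → T (delete x G u v)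
    arc e (yu , u≢x) (yv , v≢x) =
      delete⁺ G (⊆symᵃ (Induced E Y) _ _ (induced⁺ E Y e yu yv)) u≢x v≢x

  -- After deleting x ≠ z, a vertex z of Y still reaches a vertex of X other
  -- than x: the simple ear through z misses x before z or after z.
  to-X-avoiding : ∀ {x z} → T (Y z) → z ≢ x → ∃ λ h → T (X h) × h ≢ x × Path (delete x G) z h
  to-X-avoiding {x} {z} yz z≢x with Y-cases yz
  ... | inj₁ xz = z , xz , z≢x , here
  ... | inj₂ (s , t , xs , xt , i) with avoid-one-side (ear s t) (ear-simple s t) i z≢x
  ...   | inj₁ x∉pre = s , xs , (λ { refl → x∉pre (first∈ pre) }) ,
            reverseₚ (G-symmetric x) (ear-piece-avoiding x xs xt pre (prefix-⊆ (ear s t) i) x∉pre)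
    where
    pre : Path E s z
    pre = prefix (ear s t) i
  ...   | inj₂ x∉suf = t , xt , (λ { refl → x∉suf (last∈ suf) }) ,
            ear-piece-avoiding x xs xt suf (suffix-⊆ (ear s t) i) x∉suf
    where
    suf : Path E z t
    suf = suffix (ear s t) i

  -- Two vertices of X other than x are joined in G - x: through B - x when
  -- x ∈ X, and through B itself, which then misses x, when x ∉ X.
  within-X-avoiding : ∀ {x h₁ h₂} → T (X h₁) → T (X h₂) → h₁ ≢ x → h₂ ≢ x →
    Path (delete x G) h₁ h₂
  within-X-avoiding {x} {h₁} {h₂} x₁ x₂ h₁≢x h₂≢x with T? (X x)
  ... | yes xx = mapₚ (delete-mono x B⊆G) (proj₂ B-bic x h₁ h₂ xx x₁ x₂ h₁≢x h₂≢x)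
  ... | no x∉X = mapₚ B⊆G-x (proj₂ (proj₁ B-bic) h₁ h₂ x₁ x₂)
    where
    B⊆G-x : F ⊆ₐ delete x G
    B⊆G-x u v f = let (_ , xu , xv) = proj₂ B-sub u v f in
      delete⁺ G (B⊆G u v f) (λ { refl → x∉X xu }) (λ { refl → x∉X xv })

  Y-biconnected : Biconnected Y G
  Y-biconnected =
    connected-transport ⊆ᵥ-refl ⊆ᵥ-refl (⊆symᵃ (Induced E Y)) Y-strongly-connected , avoiding
    where
    avoiding : ∀ x u w → T (Y x) → T (Y u) → T (Y w) → u ≢ x → w ≢ x → Path (delete x G) u w
    avoiding x u w _ yu yw u≢x w≢x with to-X-avoiding yu u≢x | to-X-avoiding yw w≢x
    ... | h₁ , x₁ , h₁≢x , p₁ | h₂ , x₂ , h₂≢x , p₂ =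
      p₁ ++ₚ (within-X-avoiding x₁ x₂ h₁≢x h₂≢x ++ₚ reverseₚ (G-symmetric x) p₂)

  Y-strongly-biconnected : StronglyBiconnected Y (Induced E Y)
  Y-strongly-biconnected = Y-strongly-connected , Y-biconnected

module Correspondence {n : ℕ} (E : Digraph n) (reach : ∀ u v → Path E u v) where

  -- The arcs of a strongly biconnected component S are all arcs of D[V(S)],
  -- since adding them keeps S strongly biconnected.
  SBComponent⇒induced : ∀ {X F} → IsSBComponent E X F → ∀ u v → F u v ≡ Induced E X u v
  SBComponent⇒induced {X} {F} (sub , sb , maximal) u v = T-ext {F u v} (F⊆I u v) (I⊆F u v)
    where
    F⊆I : F ⊆ₐ Induced E X
    F⊆I = subdigraph⊆induced sub
    I⊆F : Induced E X ⊆ₐ F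
    I⊆F = proj₂ (maximal X (Induced E X) (induced-subdigraph E X)
                   (induced-strongly-biconnected sub sb) (⊆ᵥ-refl , F⊆I))

  -- 𝒢(D[V(S)]) is a biconnected component: a biconnected B ⊇ 𝒢(D[V(S)])
  -- has an ear extension Y with D[Y] ⊇ S strongly biconnected, so V(B) ⊆ Y ⊆ V(S).
  SBComponent⇒biconnectedComponent : ∀ {X F} → IsSBComponent E X F →
    IsBiconnectedComponent (symᵃ E) X (symᵃ (Induced E X))
  SBComponent⇒biconnectedComponent {X} {F} (sub , sb , maximal) =
    subdigraph⇒subgraph (induced-subdigraph E X) ,
    proj₂ (induced-strongly-biconnected sub sb) ,
    maximal'
    where
    maximal' : ∀ X' F' → IsSubgraph (symᵃ E) X' F' → Biconnected X' F' →
      (X , symᵃ (Induced E X)) ⊑ (X' , F') → (X' , F') ⊑ (X , symᵃ (Induced E X))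
    maximal' X' F' sub' bic' (X⊆X' , _) =
      X'⊆X , ⊆ₐ-trans (subgraph⊆sym-induced E sub') (symᵃ-mono (induced-mono E X'⊆X))
      where
      open EarExtension E reach X' F' sub' bic' renaming (X⊆Y to X'⊆Y)
      X⊆Y : X ⊆ᵥ Y
      X⊆Y = ⊆ᵥ-trans X⊆X' X'⊆Y
      Y⊆X : Y ⊆ᵥ X
      Y⊆X = proj₁ (maximal Y (Induced E Y) (induced-subdigraph E Y) Y-strongly-biconnected
                     (X⊆Y , ⊆ₐ-trans (subdigraph⊆induced sub) (induced-mono E X⊆Y)))
      X'⊆X : X' ⊆ᵥ X
      X'⊆X = ⊆ᵥ-trans X'⊆Y Y⊆X

  -- For a biconnected component B, the ear extension of B is again a
  -- biconnected subgraph containing B, so it adds no vertices; hence D[V(B)]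
  -- is strongly connected, and it is maximal because the underlying graph of
  -- any strongly biconnected S ⊇ D[V(B)] is a biconnected subgraph containing B.
  biconnectedComponent⇒SBComponent : ∀ {X B} → IsBiconnectedComponent (symᵃ E) X B →
    IsSBComponent E X (Induced E X)
  biconnectedComponent⇒SBComponent {X} {B} (sub , bic , maximal) =
    induced-subdigraph E X ,
    (strong , biconnected-transport ⊆ᵥ-refl ⊆ᵥ-refl (subgraph⊆sym-induced E sub) bic) ,
    maximal'
    where
    open EarExtension E reach X B sub bic
    Y⊆X : Y ⊆ᵥ X
    Y⊆X = proj₁ (maximal Y G (subdigraph⇒subgraph (induced-subdigraph E Y)) Y-biconnected
                   (X⊆Y , B⊆G))
    strong : StronglyConnected X (Induced E X)
    strong = connected-transport Y⊆X X⊆Y (induced-mono E Y⊆X) Y-strongly-connected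
    maximal' : ∀ X' F' → IsSubdigraph E X' F' → StronglyBiconnected X' F' →
      (X , Induced E X) ⊑ (X' , F') → (X' , F') ⊑ (X , Induced E X)
    maximal' X' F' sub' (_ , bic') (X⊆X' , I⊆F') =
      X'⊆X , ⊆ₐ-trans (subdigraph⊆induced sub') (induced-mono E X'⊆X)
      where
      X'⊆X : X' ⊆ᵥ X
      X'⊆X = proj₁ (maximal X' (symᵃ F') (subdigraph⇒subgraph sub') bic'
                      (X⊆X' , ⊆ₐ-trans (subgraph⊆sym-induced E sub) (symᵃ-mono I⊆F')))

  SBComponent-cong : ∀ {X X' F F'} → (∀ v → X v ≡ X' v) → (∀ u v → F u v ≡ F' u v) →
    IsSBComponent E X F → IsSBComponent E X' F'
  SBComponent-cong {X} {X'} {F} {F'} X≡X' F≡F' (sub , (sc , bic) , maximal) =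
    sub' ,
    (connected-transport X⊆X' X'⊆X F⊆F' sc , biconnected-transport X⊆X' X'⊆X (symᵃ-mono F⊆F') bic) ,
    maximal'
    where
    X⊆X' : X ⊆ᵥ X'
    X⊆X' = ≡⇒⊆ᵥ X≡X'
    X'⊆X : X' ⊆ᵥ X
    X'⊆X = ≡⇒⊆ᵥ (sym ∘ X≡X')
    F⊆F' : F ⊆ₐ F'
    F⊆F' = ≡⇒⊆ₐ F≡F'
    F'⊆F : F' ⊆ₐ F
    F'⊆F = ≡⇒⊆ₐ λ u v → sym (F≡F' u v)
    sub' : IsSubdigraph E X' F'
    sub' u v f = let (e , xu , xv) = sub u v (F'⊆F u v f) in e , X⊆X' u xu , X⊆X' v xv
    maximal' : ∀ X'' F'' → IsSubdigraph E X'' F'' → StronglyBiconnected X'' F'' →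
      (X' , F') ⊑ (X'' , F'') → (X'' , F'') ⊑ (X' , F')
    maximal' X'' F'' sub'' sb'' (X'⊆X'' , F'⊆F'') =
      let (X''⊆X , F''⊆F) =
            maximal X'' F'' sub'' sb'' (⊆ᵥ-trans X⊆X' X'⊆X'' , ⊆ₐ-trans F⊆F' F'⊆F'')
      in ⊆ᵥ-trans X''⊆X X⊆X' , ⊆ₐ-trans F''⊆F F⊆F'

theorem8 : (n : ℕ) (E : Digraph n) → Loopless E → StronglyConnected allV E →
    (X : VSet n) (F : ASet n) →
    IsSBComponent E X F ⇔
      Σ (VSet n) (λ XB → Σ (ASet n) (λ FB →
        IsBiconnectedComponent (Underlying E) XB FB ×
        (∀ v → X v ≡ XB v) × (∀ u v → F u v ≡ Induced E XB u v)))
theorem8 n E _ (_ , strong) X F = mk⇔ component⇒induced induced⇒component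
  where
  open Correspondence E (λ u v → strong u v tt tt)

  InducedByComponent : Set
  InducedByComponent = Σ (VSet n) λ XB → Σ (ASet n) λ FB →
    IsBiconnectedComponent (Underlying E) XB FB ×
    (∀ v → X v ≡ XB v) × (∀ u v → F u v ≡ Induced E XB u v)

  component⇒induced : IsSBComponent E X F → InducedByComponent
  component⇒induced S =
    X , symᵃ (Induced E X) , SBComponent⇒biconnectedComponent S , (λ _ → refl) , SBComponent⇒induced S

  induced⇒component : InducedByComponent → IsSBComponent E X F
  induced⇒component (XB , _ , B , X≡XB , F≡I) =
    SBComponent-cong (sym ∘ X≡XB) (λ u v → sym (F≡I u v)) (biconnectedComponent⇒SBComponent B)
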